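{- Suppose the input graph $G$ is a cactus graph, revealed in an admissible order $v_1,\dots,v_n$, and $2$-DOMINATE is run on it, with charges $ch$ defined as in the context. Then: (1) if two distinct vertices $v_i$ and $v_j$ both have charge equal to $1$, they have no common neighbour; (2) if two distinct vertices $v_i$ and $v_j$ both have charge equal to $1$, they are not adjacent; (3) for every vertex $v_i$, at most one vertex of $N[v_i]$ has charge equal to $1$.
   Context: A cactus graph is a connected graph in which every edge lies on at most one cycle. Online dominating set model: a finite connected simple undirected graph $G$ is revealed in an order $v_1,\dots,v_n$ such that for every $i$ the subgraph induced on $\{v_1,\dots,v_i\}$ is connected; at step $i$, $v_i$ is revealed together with its entire closed neighbourhood $N[v_i]$, and the algorithm irrevocably decides whether to select $v_i$. Notation: $R_i=\{v_1,\dots,v_i\}$, $V_i=N[R_i]$; $S_i$ = vertices among $v_1,\dots,v_i$ selected, $S_0=\emptyset$; $D_i=N[S_i]$; $U_i=V_i\setminus D_{i-1}$. $v_j$ saves $v_i$ if $j=\max\{k: v_k\in N[v_i]\}$ and $N[v_i]\setminus\{v_j\}$ contains no vertex of $S_{j-1}$; $s(v_j)$ is the set of vertices saved by $v_j$. The algorithm $k$-DOMINATE selects $v_i$ iff $|N(v_i)\cap U_i|\ge k$ or $|s(v_i)|\ge1$. Charges: for each selected vertex $v_i$ let $X_i=N[v_i]\cap U_i$; every vertex $v$ of $G$ belongs to exactly one such $X_i$, and its charge is $ch(v)=1/|X_i|$. -}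

module Defs where

open import Data.Nat using (ℕ; _≤_; _<_)
open import Data.Fin using (Fin; toℕ)
open import Data.Bool using (Bool; true; false)
open import Data.Unit using (⊤)
open import Data.List using (List; []; _∷_; _++_; [_]; zip; length)
open import Data.List.Membership.Propositional using (_∈_)
open import Data.List.Relation.Unary.All using (All)
open import Data.List.Relation.Unary.Unique.Propositional using (Unique)
open import Data.Product using (Σ; ∃; _×_; _,_)
open import Data.Sum using (_⊎_)
open import Relation.Binary.PropositionalEquality using (_≡_; _≢_)
open import Relation.Nullary using (¬_)
open import Function.Bundles using (_⇔_)

-- A finite simple undirected graph on vertex set Fin n.
-- The vertex with index i (0-based) is the revealed vertex v_{i+1}:
-- the reveal order is the order of indices.
record Graph (n : ℕ) : Set where
  field
    adj    : Fin n → Fin n → Bool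
    sym    : ∀ u v → adj u v ≡ adj v u
    irrefl : ∀ u → adj u u ≡ false

cycleEdges : ∀ {A : Set} → List A → List (A × A)
cycleEdges []       = []
cycleEdges (x ∷ xs) = zip (x ∷ xs) (xs ++ [ x ])

module _ {n : ℕ} (G : Graph n) where
  open Graph G

  Adj : Fin n → Fin n → Set
  Adj u v = adj u v ≡ true

  InN : Fin n → Fin n → Set
  InN u w = (w ≡ u) ⊎ Adj u w

  data PathIn (P : Fin n → Set) : Fin n → Fin n → Set where
    here : ∀ {u} → P u → PathIn P u u
    step : ∀ {u v w} → P u → Adj u v → PathIn P v w → PathIn P u w

  Connected : Set
  Connected = ∀ u v → PathIn (λ _ → ⊤) u v

  IsCycle : List (Fin n) → Set
  IsCycle c = (3 ≤ length c) × Unique c × All (λ { (a , b) → Adj a b }) (cycleEdges c)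

  CycleEdge : List (Fin n) → Fin n → Fin n → Set
  CycleEdge c x y = ((x , y) ∈ cycleEdges c) ⊎ ((y , x) ∈ cycleEdges c)

  -- Cactus: connected, and every edge lies on at most one cycle
  -- (two cycles through a common edge have the same edge set, i.e. are the same cycle).
  IsCactus : Set
  IsCactus = Connected ×
    (∀ c₁ c₂ x y → IsCycle c₁ → IsCycle c₂ → Adj x y →
       CycleEdge c₁ x y → CycleEdge c₂ x y →
       ∀ a b → CycleEdge c₁ a b ⇔ CycleEdge c₂ a b)

  Admissible : Set
  Admissible = ∀ (i u w : Fin n) → toℕ u ≤ toℕ i → toℕ w ≤ toℕ i →
    PathIn (λ x → toℕ x ≤ toℕ i) u w

  module _ (sel : Fin n → Bool) where
    Sel : Fin n → Set
    Sel u = sel u ≡ true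

    InV : Fin n → Fin n → Set
    InV i w = ∃ λ u → toℕ u ≤ toℕ i × InN u w

    InDprev : Fin n → Fin n → Set
    InDprev i w = ∃ λ u → toℕ u < toℕ i × Sel u × InN u w

    InU : Fin n → Fin n → Set
    InU i w = InV i w × ¬ InDprev i w

    Saves : Fin n → Fin n → Set
    Saves j i = InN i j
              × (∀ k → InN i k → toℕ k ≤ toℕ j)
              × (∀ k → InN i k → k ≢ j → toℕ k < toℕ j → ¬ Sel k)

    Rule2 : Fin n → Set
    Rule2 i = (∃ λ a → ∃ λ b → a ≢ b × Adj i a × InU i a × Adj i b × InU i b)
            ⊎ (∃ λ w → Saves i w)

    Is2Dominate : Set
    Is2Dominate = ∀ i → Sel i ⇔ Rule2 i

    InX : Fin n → Fin n → Set
    InX i w = InN i w × InU i w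

    -- ch(v) = 1: the (unique) selected v_i with v ∈ X_i has |X_i| = 1.
    ChargeOne : Fin n → Set
    ChargeOne v = ∃ λ i → Sel i × InX i v × (∀ w → InX i w → w ≡ v)

-- A vertex v of charge 1 is saved by the selected vertex s with X_s = {v}, so s is the
-- last vertex of N[v] to be revealed and the only selected one. Two such vertices a ≠ b
-- with a common neighbour x are both undominated when x is revealed, so x is selected by
-- the first rule and is the saver of both. If instead a and b are adjacent, b revealed
-- first, then a and b stay unselected, and the first rule forces selected vertices u < a
-- next to the saver of a, u' < b next to the saver of b, and w < b next to the successor
-- k of b on a path from b to u below a. Admissibility closes these into two cycles through
-- the edge b–k, one through a and one avoiding a, which a cactus forbids.
module Submission where

open import Defs
open import Data.Nat using (ℕ; s≤s; z≤n)
import Data.Nat.Properties as ℕ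
open import Data.Fin using (Fin; toℕ; _≤_; _<_)
open import Data.Fin.Properties
  using (<-trans; <⇒≢; ≤∧≢⇒<; <-cmp; ≤-refl; any?) renaming (_≟_ to _≟ᶠ_)
open import Data.Bool using (Bool; true) renaming (_≟_ to _≟ᵇ_)
open import Data.Product using (_×_; ∃; Σ; _,_; proj₁; proj₂)
open import Data.Sum using (_⊎_; inj₁; inj₂)
open import Data.Empty using (⊥; ⊥-elim)
open import Data.List using (List; []; _∷_; _++_; [_]; zip)
open import Data.List.Membership.Propositional using (_∈_; _∉_)
open import Data.List.Membership.Propositional.Properties using (∈-++⁻)
import Data.List.Membership.DecPropositional as DecMembership
open import Data.List.Relation.Unary.Any using (here; there)
open import Data.List.Relation.Unary.All as All using (All; []; _∷_)
open import Data.List.Relation.Unary.All.Properties.Core using (¬Any⇒All¬)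
open import Data.List.Relation.Unary.AllPairs using ([]; _∷_)
open import Data.List.Relation.Unary.Unique.Propositional using (Unique)
open import Relation.Binary.Definitions using (tri<; tri≈; tri>)
open import Relation.Binary.PropositionalEquality using (_≡_; _≢_; refl; sym; trans; subst)
open import Relation.Nullary using (¬_; Dec; yes; no)
open import Relation.Nullary.Decidable using (_×-dec_; _⊎-dec_)
open import Function.Bundles using (Equivalence)

zip-∈ˡ : ∀ {A B : Set} {x : A} {y : B} xs ys → (x , y) ∈ zip xs ys → x ∈ xs
zip-∈ˡ (_ ∷ _)  (_ ∷ _)  (here refl) = here refl
zip-∈ˡ (_ ∷ xs) (_ ∷ ys) (there m)   = there (zip-∈ˡ xs ys m)

zip-∈ʳ : ∀ {A B : Set} {x : A} {y : B} xs ys → (x , y) ∈ zip xs ys → y ∈ ys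
zip-∈ʳ (_ ∷ _)  (_ ∷ _)  (here refl) = here refl
zip-∈ʳ (_ ∷ xs) (_ ∷ ys) (there m)   = there (zip-∈ʳ xs ys m)

cycleEdges-∈ˡ : ∀ {A : Set} {x y : A} c → (x , y) ∈ cycleEdges c → x ∈ c
cycleEdges-∈ˡ (z ∷ c) m = zip-∈ˡ (z ∷ c) (c ++ [ z ]) m

cycleEdges-∈ʳ : ∀ {A : Set} {x y : A} c → (x , y) ∈ cycleEdges c → y ∈ c
cycleEdges-∈ʳ (z ∷ c) m with ∈-++⁻ c (zip-∈ʳ (z ∷ c) (c ++ [ z ]) m)
... | inj₁ y∈c         = there y∈c
... | inj₂ (here refl) = here refl

All<⇒All≢ : ∀ {n} {m : Fin n} {xs} → All (_< m) xs → All (m ≢_) xs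
All<⇒All≢ = All.map (λ z<m m≡z → <⇒≢ z<m (sym m≡z))

module _ {n : ℕ} (G : Graph n) where

  Adj-sym : ∀ {u v} → Adj G u v → Adj G v u
  Adj-sym {u} {v} uv = trans (Graph.sym G v u) uv

  Adj-irrefl : ∀ {u} → ¬ Adj G u u
  Adj-irrefl {u} uu with trans (sym uu) (Graph.irrefl G u)
  ... | ()

  InN-sym : ∀ {u w} → InN G u w → InN G w u
  InN-sym (inj₁ w≡u) = inj₁ (sym w≡u)
  InN-sym (inj₂ uw)  = inj₂ (Adj-sym uw)

  InN⇒Adj : ∀ {u w} → InN G u w → w ≢ u → Adj G u w
  InN⇒Adj (inj₁ w≡u) w≢u = ⊥-elim (w≢u w≡u)
  InN⇒Adj (inj₂ uw)  _   = uw

  InN? : ∀ u w → Dec (InN G u w)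
  InN? u w = (w ≟ᶠ u) ⊎-dec (Graph.adj G u w ≟ᵇ true)

  cycleEdge-∈ : ∀ {c x y} → CycleEdge G c x y → x ∈ c
  cycleEdge-∈ {c} (inj₁ xy) = cycleEdges-∈ˡ c xy
  cycleEdge-∈ {c} (inj₂ yx) = cycleEdges-∈ʳ c yx

  cactus-sharedEdge⇒∈ : IsCactus G → ∀ {c₁ c₂ x y a b} → IsCycle G c₁ → IsCycle G c₂ →
    Adj G x y → CycleEdge G c₁ x y → CycleEdge G c₂ x y → CycleEdge G c₁ a b → a ∈ c₂
  cactus-sharedEdge⇒∈ (_ , oneCycle) C₁ C₂ xy e₁ e₂ ab =
    cycleEdge-∈ (Equivalence.to (oneCycle _ _ _ _ C₁ C₂ xy e₁ e₂ _ _) ab)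

  -- Split in two so that vertices p reduces to x ∷ _ for every path p out of x.
  vertices : ∀ {P x y} → PathIn G P x y → List (Fin n)
  laterVertices : ∀ {P x y} → PathIn G P x y → List (Fin n)
  vertices {x = x} p = x ∷ laterVertices p
  laterVertices (here _)     = []
  laterVertices (step _ _ p) = vertices p

  All-vertices : ∀ {P x y} (p : PathIn G P x y) → All P (vertices p)
  All-vertices (here px)     = px ∷ []
  All-vertices (step px _ p) = px ∷ All-vertices p

  head-P : ∀ {P x y} → PathIn G P x y → P x
  head-P (here px)     = px
  head-P (step px _ _) = px

  mapPath : ∀ {P Q : Fin n → Set} {x y} → (∀ {z} → P z → Q z) → PathIn G P x y → PathIn G Q x y
  mapPath f (here pz)     = here (f pz)
  mapPath f (step pz e p) = step (f pz) e (mapPath f p)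

  SimplePath : (Fin n → Set) → Fin n → Fin n → Set
  SimplePath P x y = Σ (PathIn G P x y) (λ p → Unique (vertices p))

  suffixFrom : ∀ {P v x y} (p : PathIn G P v y) → x ∈ vertices p → Unique (vertices p) →
               SimplePath P x y
  suffixFrom p            (here refl) p-simple       = p , p-simple
  suffixFrom (step _ _ p) (there x∈p) (_ ∷ p-simple) = suffixFrom p x∈p p-simple

  simplify : ∀ {P x y} → PathIn G P x y → SimplePath P x y
  simplify (here px) = here px , [] ∷ []
  simplify {x = x} (step px e p) with simplify p
  ... | q , q-simple with DecMembership._∈?_ _≟ᶠ_ x (vertices q)
  ...   | yes x∈q = suffixFrom q x∈q q-simple
  ...   | no  x∉q = step px e q , ¬Any⇒All¬ (vertices q) x∉q ∷ q-simple

  path-below : Admissible G → ∀ {m x y : Fin n} → x < m → y < m → PathIn G (_< m) x y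
  path-below admissible {x = x} {y} x<m y<m with toℕ x ℕ.≤? toℕ y
  ... | yes x≤y = mapPath (λ z≤y → ℕ.≤-<-trans z≤y y<m) (admissible y x y x≤y ≤-refl)
  ... | no  x≰y = mapPath (λ z≤x → ℕ.≤-<-trans z≤x x<m)
                    (admissible x x y ≤-refl (ℕ.<⇒≤ (ℕ.≰⇒> x≰y)))

  path-edges : ∀ {P w x y z} → Adj G w x → (p : PathIn G P x y) → Adj G y z →
    All (λ e → Adj G (proj₁ e) (proj₂ e)) (zip (w ∷ vertices p) (vertices p ++ [ z ]))
  path-edges wx (here _)     yz = wx ∷ yz ∷ []
  path-edges wx (step _ e p) yz = wx ∷ path-edges e p yz

  path-cycle : ∀ {P x y z w} (p : PathIn G P x y) → Adj G z w → Adj G w x → Adj G y z →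
               Unique (z ∷ w ∷ vertices p) → IsCycle G (z ∷ w ∷ vertices p)
  path-cycle p zw wx yz distinct = s≤s (s≤s (s≤s z≤n)) , distinct , zw ∷ path-edges wx p yz

module Run {n : ℕ} (G : Graph n) (sel : Fin n → Bool) (dom : Is2Dominate G sel) where

  InDprev? : ∀ i w → Dec (InDprev G sel i w)
  InDprev? i w = any? (λ u → (toℕ u ℕ.<? toℕ i) ×-dec ((sel u ≟ᵇ true) ×-dec InN? G u w))

  twoNewNeighbours⇒Sel : ∀ {i a b} → Adj G i a → InU G sel i a → Adj G i b → InU G sel i b →
                         a ≢ b → Sel G sel i
  twoNewNeighbours⇒Sel ia ua ib ub a≢b =
    Equivalence.from (dom _) (inj₁ (_ , _ , a≢b , ia , ua , ib , ub))

  ¬Sel⇒otherNeighbours-InDprev : ∀ {i a k} → ¬ Sel G sel i → Adj G i a → InU G sel i a →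
                                 Adj G i k → k ≢ a → InDprev G sel i k
  ¬Sel⇒otherNeighbours-InDprev {i} {k = k} ¬si ia ua ik k≢a with InDprev? i k
  ... | yes dominated = dominated
  ... | no  new       =
    ⊥-elim (¬si (twoNewNeighbours⇒Sel ia ua ik ((i , ≤-refl , inj₂ ik) , new)
                                     (λ a≡k → k≢a (sym a≡k))))

  Saves⇒InX : ∀ {i w} → Saves G sel i w → InX G sel i w
  Saves⇒InX (wi , _ , earlier-unselected) =
    InN-sym G wi , (_ , ≤-refl , InN-sym G wi) ,
    λ { (u , u<i , su , uw) → earlier-unselected u (InN-sym G uw) (<⇒≢ u<i) u<i su }

  record Saved (v : Fin n) : Set where
    field
      saver    : Fin n
      selected : Sel G sel saver
      saves    : Saves G sel saver v
      alone    : ∀ w → InX G sel saver w → w ≡ v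

  open Saved

  -- X_i = {v} rules out the first selection rule, so v_i saves some w; saved vertices lie in X_i.
  chargeOne⇒Saved : ∀ {v} → ChargeOne G sel v → Saved v
  chargeOne⇒Saved (i , si , _ , X≡[v]) with Equivalence.to (dom i) si
  ... | inj₁ (a , b , a≢b , ia , ua , ib , ub) =
    ⊥-elim (a≢b (trans (X≡[v] a (inj₂ ia , ua)) (sym (X≡[v] b (inj₂ ib , ub)))))
  ... | inj₂ (w , i-saves-w) = record
    { saver    = i
    ; selected = si
    ; saves    = subst (Saves G sel i) (X≡[v] w (Saves⇒InX i-saves-w)) i-saves-w
    ; alone    = X≡[v]
    }

  module _ {v} (S : Saved v) where

    InN≤saver : ∀ {k} → InN G v k → k ≤ saver S
    InN≤saver = proj₁ (proj₂ (saves S)) _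

    InN<saver⇒¬Sel : ∀ {k} → InN G v k → k < saver S → ¬ Sel G sel k
    InN<saver⇒¬Sel vk k<s = proj₂ (proj₂ (saves S)) _ vk (<⇒≢ k<s) k<s

    InN-Sel⇒saver : ∀ {k} → InN G v k → Sel G sel k → k ≡ saver S
    InN-Sel⇒saver {k} vk sk with k ≟ᶠ saver S
    ... | yes k≡s = k≡s
    ... | no  k≢s = ⊥-elim (InN<saver⇒¬Sel vk (≤∧≢⇒< (InN≤saver vk) k≢s) sk)

    Saved⇒InU : ∀ {x} → InN G x v → InU G sel x v
    Saved⇒InU {x} xv = (x , ≤-refl , xv) ,
      λ { (u , u<x , su , uv) →
            InN<saver⇒¬Sel (InN-sym G uv) (ℕ.<-≤-trans u<x (InN≤saver (InN-sym G xv))) su }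

  saver-injective : ∀ {a b} (Sa : Saved a) (Sb : Saved b) → saver Sa ≡ saver Sb → a ≡ b
  saver-injective Sa Sb sa≡sb =
    alone Sb _ (subst (λ s → InX G sel s _) sa≡sb (Saves⇒InX (saves Sa)))

  commonNeighbour-Saved⇒≡ : ∀ {x a b} → Adj G x a → Adj G x b → Saved a → Saved b → a ≡ b
  commonNeighbour-Saved⇒≡ {x} {a} {b} xa xb Sa Sb with a ≟ᶠ b
  ... | yes a≡b = a≡b
  ... | no  a≢b = saver-injective Sa Sb
                    (trans (sym (InN-Sel⇒saver Sa (inj₂ (Adj-sym G xa)) sx))
                           (InN-Sel⇒saver Sb (inj₂ (Adj-sym G xb)) sx))
    where
      sx : Sel G sel x
      sx = twoNewNeighbours⇒Sel xa (Saved⇒InU Sa (inj₂ xa)) xb (Saved⇒InU Sb (inj₂ xb)) a≢b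

  module AdjacentSaved (cactus : IsCactus G) (admissible : Admissible G) {a b : Fin n}
                       (ab : Adj G a b) (b<a : b < a) (Sa : Saved a) (Sb : Saved b) where

    sa sb : Fin n
    sa = saver Sa
    sb = saver Sb

    ¬Sel-a : ¬ Sel G sel a
    ¬Sel-a sel-a = <⇒≢ b<a (sym (saver-injective Sa Sb
      (trans (sym (InN-Sel⇒saver Sa (inj₁ refl) sel-a))
             (InN-Sel⇒saver Sb (inj₂ (Adj-sym G ab)) sel-a))))

    saver-above-a : ∀ {v} (S : Saved v) → InN G v a → a < saver S
    saver-above-a S va = ≤∧≢⇒< (InN≤saver S va)
      (λ a≡s → ¬Sel-a (subst (Sel G sel) (sym a≡s) (selected S)))

    a<sa : a < sa
    a<sa = saver-above-a Sa (inj₁ refl)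

    a<sb : a < sb
    a<sb = saver-above-a Sb (inj₂ (Adj-sym G ab))

    b<sb : b < sb
    b<sb = <-trans b<a a<sb

    ¬Sel-b : ¬ Sel G sel b
    ¬Sel-b = InN<saver⇒¬Sel Sa (inj₂ ab) (<-trans b<a a<sa)

    a-sa : Adj G a sa
    a-sa = InN⇒Adj G (proj₁ (saves Sa)) (λ sa≡a → <⇒≢ a<sa (sym sa≡a))

    b-sb : Adj G b sb
    b-sb = InN⇒Adj G (proj₁ (saves Sb)) (λ sb≡b → <⇒≢ b<sb (sym sb≡b))

    dominatedNeighbour : ∀ {x s} → InDprev G sel x s → x < s →
                         ∃ λ (u : Fin n) → u < x × Sel G sel u × Adj G u s
    dominatedNeighbour (u , u<x , su , us) x<s =
      u , u<x , su , InN⇒Adj G us (λ s≡u → <⇒≢ (<-trans u<x x<s) (sym s≡u))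

    sa-dominated : ∃ λ (u : Fin n) → u < a × Sel G sel u × Adj G u sa
    sa-dominated = dominatedNeighbour (¬Sel⇒otherNeighbours-InDprev ¬Sel-a ab
      (Saved⇒InU Sb (inj₂ ab)) a-sa (λ sa≡b → <⇒≢ (<-trans b<a a<sa) (sym sa≡b))) a<sa

    sb-dominated : ∃ λ (u : Fin n) → u < b × Sel G sel u × Adj G u sb
    sb-dominated = dominatedNeighbour (¬Sel⇒otherNeighbours-InDprev ¬Sel-b (Adj-sym G ab)
      (Saved⇒InU Sa (inj₂ (Adj-sym G ab))) b-sb (λ sb≡a → <⇒≢ a<sb (sym sb≡a))) b<sb

    neighbour-b-dominated : ∀ {k} → Adj G b k → k < a → ∃ λ (w : Fin n) → w < b × Adj G w k
    neighbour-b-dominated {k} b-k k<a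
      with ¬Sel⇒otherNeighbours-InDprev ¬Sel-b (Adj-sym G ab) (Saved⇒InU Sa (inj₂ (Adj-sym G ab)))
             b-k (<⇒≢ k<a)
    ... | w , w<b , sw , wk = w , w<b , InN⇒Adj G wk (λ k≡w →
            InN<saver⇒¬Sel Sb (inj₂ b-k) (<-trans k<a a<sb) (subst (Sel G sel) (sym k≡w) sw))

    cycle-avoiding-a : ∀ {k u'} → Adj G b k → k < a → k ≢ b → u' < b → Adj G u' sb →
      Σ (List (Fin n)) λ vs → IsCycle G (sb ∷ b ∷ k ∷ vs) × a ∉ sb ∷ b ∷ k ∷ vs
    cycle-avoiding-a b-k k<a k≢b u'<b u'-sb with neighbour-b-dominated b-k k<a
    ... | w , w<b , w-k with simplify G (step (k<a , k≢b) (Adj-sym G w-k)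
           (mapPath G (λ z<b → <-trans z<b b<a , <⇒≢ z<b) (path-below G admissible w<b u'<b)))
    ... | r , r-simple =
      laterVertices G r , path-cycle G r (Adj-sym G b-sb) b-k u'-sb distinct , a∉
      where
        r-below = All-vertices G r
        distinct : Unique (sb ∷ b ∷ vertices G r)
        distinct = All<⇒All≢ (b<sb ∷ All.map (λ z → <-trans (proj₁ z) a<sb) r-below)
                 ∷ All.map (λ z b≡z → proj₂ z (sym b≡z)) r-below
                 ∷ r-simple
        a∉ : a ∉ sb ∷ b ∷ vertices G r
        a∉ (here a≡sb)         = <⇒≢ a<sb a≡sb
        a∉ (there (here a≡b))  = <⇒≢ b<a (sym a≡b)
        a∉ (there (there a∈r))  = <⇒≢ (proj₁ (All.lookup r-below a∈r)) refl

    cycle-through-ab : ∀ {k u} (q : PathIn G (_< a) k u) → Adj G b k → All (b ≢_) (vertices G q) →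
      Unique (vertices G q) → Adj G u sa → IsCycle G (sa ∷ a ∷ b ∷ vertices G q)
    cycle-through-ab q b-k b∉q q-simple u-sa = path-cycle G (step b<a b-k q) (Adj-sym G a-sa) ab u-sa
      ( All<⇒All≢ (a<sa ∷ <-trans b<a a<sa ∷ All.map (λ z<a → <-trans z<a a<sa) q-below)
      ∷ All<⇒All≢ (b<a ∷ q-below)
      ∷ b∉q ∷ q-simple )
      where q-below = All-vertices G q

    absurd : ⊥
    absurd with sa-dominated | sb-dominated
    ... | u , u<a , su , u-sa | u' , u'<b , _ , u'-sb with simplify G (path-below G admissible b<a u<a)
    ... | here _ , _ = ¬Sel-b su
    ... | step _ b-k q , b∉q ∷ q-simple
      with cycle-avoiding-a b-k (head-P G q) (λ k≡b → All.head b∉q (sym k≡b)) u'<b u'-sb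
    ... | _ , cycleB , a∉B = a∉B (cactus-sharedEdge⇒∈ G cactus
            (cycle-through-ab q b-k b∉q q-simple u-sa) cycleB b-k
            (inj₁ (there (there (here refl)))) (inj₁ (there (here refl))) (inj₁ (there (here refl))))

  adjacent-Saved⇒⊥ : IsCactus G → Admissible G → ∀ {a b} → Adj G a b → Saved a → Saved b → ⊥
  adjacent-Saved⇒⊥ cactus admissible {a} {b} ab Sa Sb with <-cmp a b
  ... | tri< a<b _ _  = AdjacentSaved.absurd cactus admissible (Adj-sym G ab) a<b Sb Sa
  ... | tri≈ _ refl _ = Adj-irrefl G ab
  ... | tri> _ _ b<a  = AdjacentSaved.absurd cactus admissible ab b<a Sa Sb

  closedNeighbourhood-Saved⇒≡ : IsCactus G → Admissible G → ∀ {x a b} →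
    InN G x a → InN G x b → Saved a → Saved b → a ≡ b
  closedNeighbourhood-Saved⇒≡ _ _ (inj₁ refl) (inj₁ refl) _ _ = refl
  closedNeighbourhood-Saved⇒≡ c adm (inj₁ refl) (inj₂ ab) Sa Sb =
    ⊥-elim (adjacent-Saved⇒⊥ c adm ab Sa Sb)
  closedNeighbourhood-Saved⇒≡ c adm (inj₂ ba) (inj₁ refl) Sa Sb =
    ⊥-elim (adjacent-Saved⇒⊥ c adm ba Sb Sa)
  closedNeighbourhood-Saved⇒≡ _ _ (inj₂ xa) (inj₂ xb) Sa Sb = commonNeighbour-Saved⇒≡ xa xb Sa Sb

lemma5 : ∀ {n : ℕ} (G : Graph n) → IsCactus G → Admissible G →
    (sel : Fin n → Bool) → Is2Dominate G sel →
    ((u v : Fin n) → u ≢ v → ChargeOne G sel u → ChargeOne G sel v →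
       ¬ (∃ λ w → Adj G u w × Adj G v w))
    × ((u v : Fin n) → u ≢ v → ChargeOne G sel u → ChargeOne G sel v → ¬ Adj G u v)
    × ((x a b : Fin n) → InN G x a → InN G x b →
       ChargeOne G sel a → ChargeOne G sel b → a ≡ b)
lemma5 G cactus admissible sel dom = noCommonNeighbour , nonAdjacent , atMostOneInN
  where
    open Run G sel dom

    atMostOneInN : ∀ x a b → InN G x a → InN G x b →
                   ChargeOne G sel a → ChargeOne G sel b → a ≡ b
    atMostOneInN _ _ _ xa xb ca cb =
      closedNeighbourhood-Saved⇒≡ cactus admissible xa xb (chargeOne⇒Saved ca) (chargeOne⇒Saved cb)

    noCommonNeighbour : ∀ u v → u ≢ v → ChargeOne G sel u → ChargeOne G sel v →
                        ¬ (∃ λ w → Adj G u w × Adj G v w)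
    noCommonNeighbour u v u≢v cu cv (w , uw , vw) =
      u≢v (atMostOneInN w u v (inj₂ (Adj-sym G uw)) (inj₂ (Adj-sym G vw)) cu cv)

    nonAdjacent : ∀ u v → u ≢ v → ChargeOne G sel u → ChargeOne G sel v → ¬ Adj G u v
    nonAdjacent u v u≢v cu cv uv = u≢v (atMostOneInN u u v (inj₁ refl) (inj₂ uv) cu cv)
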